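{- There exist uncountably many isomorphism classes of the graphs $\Gamma_w$, $w\in Y\times X^\infty$ (where $X=\{0,1,\ldots,7\}$, $Y=\{a,b,c,d\}$), regarded as unrooted graphs.
   Context: Construction. Let $t_0=(0,0)$, $t_1=(1,0)$, $t_2=(2,0)$, $t_3=(2,1)$, $t_4=(2,2)$, $t_5=(1,2)$, $t_6=(0,2)$, $t_7=(0,1)$; these are the lower-left corners of the eight outer unit cells of the $3\times 3$ grid $[0,3]^2$ (the middle cell is omitted). The graph $\Gamma_1$ is the 4-cycle embedded as the unit square with vertices $a=(0,0)$, $b=(1,0)$, $c=(1,1)$, $d=(0,1)$ and its four sides as edges. For $n\ge1$, $\Gamma_{n+1}$ is the union of the eight translated copies $\Gamma_n+3^{n-1}t_k$, $k=0,\ldots,7$ (vertices with equal coordinates identified, edge sets united); adjacent copies share a common side and the middle cell is empty except for its boundary. For a finite word $yx_1\ldots x_{n-1}$ ($y\in Y$, $x_i\in X$) the corresponding vertex of $\Gamma_n$ is the point $p(y)+\sum_{i=1}^{n-1}3^{i-1}t_{x_i}$, where $p(a)=(0,0),p(b)=(1,0),p(c)=(1,1),p(d)=(0,1)$. For $w=yx_1x_2\ldots\in Y\times X^\infty$ let $w_n=yx_1\ldots x_{n-1}$ and let $\Gamma^n_w$ be $\Gamma_n$ rooted at the vertex $w_n$ (equivalently, $\Gamma^{n+1}_w$ is built from 8 copies of $\Gamma^n_w$ in positions $0,\ldots,7$ with root the root of the copy in position $x_n$). The infinite rooted graph $\Gamma_w$ is the limit of $\Gamma^n_w$ in the sense that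 for each $r>0$ the ball of radius $r$ about the root of $\Gamma_w$ is isomorphic to the ball of radius $r$ about $w_n$ in $\Gamma^n_w$ for all large $n$ (concretely, the increasing union of the $\Gamma^n_w$ translated so that their roots are at the origin). -}

module Defs where

open import Data.Nat using (ℕ; zero; suc)
open import Data.Fin using (Fin; zero; suc)
open import Data.Integer using (ℤ; +_; _+_; _-_; _*_)
open import Data.Product using (Σ; ∃; _×_; _,_)
open import Data.Sum using (_⊎_)
open import Relation.Binary.PropositionalEquality using (_≡_)
open import Function.Bundles using (_⇔_)

Point : Set
Point = ℤ × ℤ

_⊕_ : Point → Point → Point
(x , y) ⊕ (x' , y') = (x + x' , y + y')

_⊖_ : Point → Point → Point
(x , y) ⊖ (x' , y') = (x - x' , y - y')

scale : ℤ → Point → Point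
scale s (x , y) = (s * x , s * y)

pow3 : ℕ → ℤ
pow3 zero    = + 1
pow3 (suc m) = + 3 * pow3 m

X : Set
X = Fin 8

data Y : Set where
  a b c d : Y

t : X → Point
t zero = (+ 0 , + 0)
t (suc zero) = (+ 1 , + 0)
t (suc (suc zero)) = (+ 2 , + 0)
t (suc (suc (suc zero))) = (+ 2 , + 1)
t (suc (suc (suc (suc zero)))) = (+ 2 , + 2)
t (suc (suc (suc (suc (suc zero))))) = (+ 1 , + 2)
t (suc (suc (suc (suc (suc (suc zero)))))) = (+ 0 , + 2)
t (suc (suc (suc (suc (suc (suc (suc zero))))))) = (+ 0 , + 1)

pos : Y → Point
pos a = (+ 0 , + 0)
pos b = (+ 1 , + 0)
pos c = (+ 1 , + 1)
pos d = (+ 0 , + 1)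

data SquareEdge : Point → Point → Set where
  ab : SquareEdge (pos a) (pos b)
  ba : SquareEdge (pos b) (pos a)
  bc : SquareEdge (pos b) (pos c)
  cb : SquareEdge (pos c) (pos b)
  cd : SquareEdge (pos c) (pos d)
  dc : SquareEdge (pos d) (pos c)
  da : SquareEdge (pos d) (pos a)
  ad : SquareEdge (pos a) (pos d)

-- Edge m p q : {p,q} is an edge of Γ_{m+1} (embedded in the plane).
-- Γ_{m+2} is the union of the copies Γ_{m+1} + 3^m t_k.
Edge : ℕ → Point → Point → Set
Edge zero    p q = SquareEdge p q
Edge (suc m) p q = Σ X λ k → Edge m (p ⊖ scale (pow3 m) (t k)) (q ⊖ scale (pow3 m) (t k))

-- Infinite words w = y x_1 x_2 … ; the sequence x is indexed from 0, i.e. x i = x_{i+1}.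
W : Set
W = Y × (ℕ → X)

-- Position of the root w_{m+1} = y x_1 … x_m in Γ_{m+1}:
-- p(y) + Σ_{i=1}^{m} 3^{i-1} t_{x_i}.
root : W → ℕ → Point
root (y , x) zero    = pos y
root (y , x) (suc m) = root (y , x) m ⊕ scale (pow3 m) (t (x m))

-- The infinite graph Γ_w: increasing union of the Γ^n_w translated so
-- that their roots are at the origin.
Adj : W → Point → Point → Set
Adj w u v = Σ ℕ λ m → Edge m (u ⊕ root w m) (v ⊕ root w m)

Vertex : W → Point → Set
Vertex w u = Σ Point λ v → Adj w u v

Iso : W → W → Set
Iso w w' =
  Σ (Point → Point) λ f → Σ (Point → Point) λ g →
    (∀ u → Vertex w u → Vertex w' (f u)) ×
    (∀ u → Vertex w' u → Vertex w (g u)) ×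
    (∀ u → Vertex w u → g (f u) ≡ u) ×
    (∀ u → Vertex w' u → f (g u) ≡ u) ×
    (∀ u v → Vertex w u → Vertex w v → (Adj w u v ⇔ Adj w' (f u) (f v)))

module Submission where

open import Defs
open import Data.Nat using (ℕ)
open import Data.Product using (Σ)
open import Relation.Nullary using (¬_)

open import Data.Bool using (Bool; true; false)
open import Data.Empty using (⊥; ⊥-elim)
open import Data.Fin as F using (Fin)
import Data.Fin.Properties as FP
open import Data.Integer as ℤ using (ℤ; +_; -[1+_]; _+_; _-_; _*_; -_)
import Data.Integer.DivMod as ℤD
import Data.Integer.Properties as ℤP
open import Data.Integer.Tactic.RingSolver using (solve-∀)
open import Data.Nat as ℕ using (zero; suc; z≤n; s≤s)
import Data.Nat.Properties as ℕP
import Data.Nat.Tactic.RingSolver as ℕS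
open import Data.Product using (_×_; _,_; proj₁; proj₂)
open import Data.Product.Properties using (≡-dec)
open import Data.Sum using (_⊎_; inj₁; inj₂)
open import Function.Bundles using (_⇔_; Equivalence)
open import Relation.Binary using (tri<; tri≈; tri>)
open import Relation.Binary.PropositionalEquality
open import Relation.Nullary using (Dec; yes; no)
open import Relation.Nullary.Decidable using (from-yes; map′; _×-dec_; _⊎-dec_; _→-dec_; ¬?)

-- The proof is a diagonal argument.
-- * Rigidity (§ 7–10): the unit cells of Γ_{(a,x)} are connected through common
--   sides; an isomorphism Γ_{(a,x)} ≅ Γ_{w'} sends edges injectively to unit
--   steps, so it maps the root square onto a unit square, and a square-closing
--   argument carries this from cell to cell: on all cells it is a lattice
--   isometry p ↦ v + ⟦π⟧ p, π one of the 8 symmetries of ℤ².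
-- * Holes (§ 5–6): no edge of Γ starts at a point whose two coordinates lie
--   strictly inside middle thirds of blocks of length 3^(j+1).
-- * Steering (§ 11–12): whatever the first i+1 letters of x, the next letter
--   can be chosen so that a given isometry sends a cell corner of Γ_{(a,x)}
--   into such a hole of Γ_{w'}.
-- * Diagonalisation (§ 13–15): the candidates (n, v, π) are enumerated and the
--   letter x_{i+1} steers against the i-th; if Γ_{(a,x)} ≅ Γ_{e n}, its isometry
--   was examined at some step and maps a vertex to a non-vertex.

O : Point
O = (+ 0 , + 0)

pointwise : ∀ {p q : Point} → proj₁ p ≡ proj₁ q → proj₂ p ≡ proj₂ q → p ≡ q
pointwise = cong₂ _,_

⊕-assoc : ∀ p q r → (p ⊕ q) ⊕ r ≡ p ⊕ (q ⊕ r)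
⊕-assoc (x , y) (x' , y') (x'' , y'') = pointwise (ℤP.+-assoc x x' x'') (ℤP.+-assoc y y' y'')

⊕-comm : ∀ p q → p ⊕ q ≡ q ⊕ p
⊕-comm (x , y) (x' , y') = pointwise (ℤP.+-comm x x') (ℤP.+-comm y y')

⊕-identityʳ : ∀ p → p ⊕ O ≡ p
⊕-identityʳ (x , y) = pointwise (ℤP.+-identityʳ x) (ℤP.+-identityʳ y)

⊖-⊕ : ∀ p s → (p ⊖ s) ⊕ s ≡ p
⊖-⊕ (x , y) (x' , y') = pointwise (eq x x') (eq y y')
  where eq : ∀ (x y : ℤ) → (x - y) + y ≡ x
        eq = solve-∀

⊕-⊖ : ∀ p s → (p ⊕ s) ⊖ s ≡ p
⊕-⊖ (x , y) (x' , y') = pointwise (eq x x') (eq y y')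
  where eq : ∀ (x y : ℤ) → (x + y) - y ≡ x
        eq = solve-∀

⊕-cancelˡ : ∀ p q r → p ⊕ q ≡ p ⊕ r → q ≡ r
⊕-cancelˡ p q r h = begin
  q           ≡⟨ sym (⊕-⊖ q p) ⟩
  (q ⊕ p) ⊖ p ≡⟨ cong (_⊖ p) (trans (⊕-comm q p) (trans h (⊕-comm p r))) ⟩
  (r ⊕ p) ⊖ p ≡⟨ ⊕-⊖ r p ⟩
  r           ∎
  where open ≡-Reasoning

pow3≡ : ∀ m → pow3 m ≡ + (3 ℕ.^ m)
pow3≡ zero    = refl
pow3≡ (suc m) = trans (cong (+ 3 *_) (pow3≡ m)) (sym (ℤP.pos-* 3 (3 ℕ.^ m)))

pow3-+ : ∀ m n → pow3 (m ℕ.+ n) ≡ pow3 m * pow3 n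
pow3-+ zero    n = sym (ℤP.*-identityˡ (pow3 n))
pow3-+ (suc m) n = trans (cong (+ 3 *_) (pow3-+ m n)) (sym (ℤP.*-assoc (+ 3) (pow3 m) (pow3 n)))

offset : ℕ → X → Point
offset m k = scale (pow3 m) (t k)

data Dir : Set where
  Rt Up Lf Dn : Dir

vec : Dir → Point
vec Rt = (+ 1 , + 0)
vec Up = (+ 0 , + 1)
vec Lf = (-[1+ 0 ] , + 0)
vec Dn = (+ 0 , -[1+ 0 ])

opp : Dir → Dir
opp Rt = Lf
opp Up = Dn
opp Lf = Rt
opp Dn = Up

-- Numbering the directions transfers decidable equality and exhaustive
-- checking from Fin 4; all finite facts about directions below are decided
-- by computation (from-yes).
dir : Fin 4 → Dir
dir F.zero = Rt
dir (F.suc F.zero) = Up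
dir (F.suc (F.suc F.zero)) = Lf
dir (F.suc (F.suc (F.suc F.zero))) = Dn

number : Dir → Fin 4
number Rt = F.# 0
number Up = F.# 1
number Lf = F.# 2
number Dn = F.# 3

dir-number : ∀ σ → dir (number σ) ≡ σ
dir-number Rt = refl
dir-number Up = refl
dir-number Lf = refl
dir-number Dn = refl

_≟D_ : (σ τ : Dir) → Dec (σ ≡ τ)
σ ≟D τ = map′ (λ h → trans (sym (dir-number σ)) (trans (cong dir h) (dir-number τ))) (cong number)
              (number σ FP.≟ number τ)

_≟P_ : (p q : Point) → Dec (p ≡ q)
_≟P_ = ≡-dec ℤP._≟_ ℤP._≟_

allDir? : {P : Dir → Set} → (∀ σ → Dec (P σ)) → Dec (∀ σ → P σ)
allDir? {P} P? = map′ (λ h σ → subst P (dir-number σ) (h (number σ))) (λ h i → h (dir i))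
                      (FP.all? λ i → P? (dir i))

-- Perpendicular pairs of directions; such a pair is the image of the
-- standard basis under one of the 8 symmetries of the lattice.
data Perp : Dir → Dir → Set where
  RU : Perp Rt Up
  RD : Perp Rt Dn
  LU : Perp Lf Up
  LD : Perp Lf Dn
  UR : Perp Up Rt
  UL : Perp Up Lf
  DR : Perp Dn Rt
  DL : Perp Dn Lf

perp? : ∀ σ τ → Dec (Perp σ τ)
perp? Rt Up = yes RU
perp? Rt Dn = yes RD
perp? Lf Up = yes LU
perp? Lf Dn = yes LD
perp? Up Rt = yes UR
perp? Up Lf = yes UL
perp? Dn Rt = yes DR
perp? Dn Lf = yes DL
perp? Rt Rt = no λ ()
perp? Rt Lf = no λ ()
perp? Up Up = no λ ()
perp? Up Dn = no λ ()
perp? Lf Rt = no λ ()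
perp? Lf Lf = no λ ()
perp? Dn Up = no λ ()
perp? Dn Dn = no λ ()

unitPair : ∀ α β γ δ → vec α ⊕ vec β ≡ vec γ ⊕ vec δ →
           (α ≡ γ × β ≡ δ) ⊎ (α ≡ δ × β ≡ γ) ⊎ (β ≡ opp α)
unitPair = from-yes (allDir? λ α → allDir? λ β → allDir? λ γ → allDir? λ δ →
  ((vec α ⊕ vec β) ≟P (vec γ ⊕ vec δ)) →-dec
  (((α ≟D γ) ×-dec (β ≟D δ)) ⊎-dec (((α ≟D δ) ×-dec (β ≟D γ)) ⊎-dec (β ≟D opp α))))

vec-opp : ∀ δ → vec δ ⊕ vec (opp δ) ≡ O
vec-opp = from-yes (allDir? λ δ → (vec δ ⊕ vec (opp δ)) ≟P O)

distinct⇒perp : ∀ σ τ → σ ≢ τ → τ ≢ opp σ → Perp σ τ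
distinct⇒perp = from-yes (allDir? λ σ → allDir? λ τ →
  ¬? (σ ≟D τ) →-dec (¬? (τ ≟D opp σ) →-dec perp? σ τ))

remaining : ∀ σ τ δ → Perp σ τ → δ ≢ σ → δ ≢ opp σ → δ ≢ τ → δ ≡ opp τ
remaining = from-yes (allDir? λ σ → allDir? λ τ → allDir? λ δ →
  perp? σ τ →-dec (¬? (δ ≟D σ) →-dec (¬? (δ ≟D opp σ) →-dec (¬? (δ ≟D τ) →-dec (δ ≟D opp τ)))))

-- A closed walk σ, δ₂, −δ₃, −δ₁ of unit steps (σ ⊥ τ) whose first step δ₁
-- is neither σ nor τ, and whose step δ₂ does not undo σ, goes around a unit
-- square on the side −τ: δ₁ = δ₂ = −τ.
square-closes : ∀ σ τ δ₁ δ₂ δ₃ → Perp σ τ → vec σ ⊕ vec δ₂ ≡ vec δ₁ ⊕ vec δ₃ →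
                δ₁ ≢ σ → δ₁ ≢ τ → δ₂ ≢ opp σ → δ₂ ≡ δ₁ × δ₁ ≡ opp τ
square-closes σ τ δ₁ δ₂ δ₃ π sum δ₁≢σ δ₁≢τ δ₂≢σ̄ = δ₂≡δ₁ , remaining σ τ δ₁ π δ₁≢σ (λ eq → δ₂≢σ̄ (trans δ₂≡δ₁ eq)) δ₁≢τ
  where
  δ₂≡δ₁ : δ₂ ≡ δ₁
  δ₂≡δ₁ with unitPair σ δ₂ δ₁ δ₃ sum
  ... | inj₁ (σ≡δ₁ , _)         = ⊥-elim (δ₁≢σ (sym σ≡δ₁))
  ... | inj₂ (inj₁ (_ , δ₂≡δ₁)) = δ₂≡δ₁
  ... | inj₂ (inj₂ δ₂≡σ̄)        = ⊥-elim (δ₂≢σ̄ δ₂≡σ̄)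

-- § 3. The eight symmetries of the lattice fixing the origin.

turn : Dir → Dir → Dir → Dir
turn σ τ Rt = σ
turn σ τ Up = τ
turn σ τ Lf = opp σ
turn σ τ Dn = opp τ

turn-opp : ∀ σ τ δ → turn σ τ (opp δ) ≡ opp (turn σ τ δ)
turn-opp = from-yes (allDir? λ σ → allDir? λ τ → allDir? λ δ →
  turn σ τ (opp δ) ≟D opp (turn σ τ δ))

turn-perp : ∀ σ τ α β → Perp σ τ → Perp α β → Perp (turn σ τ α) (turn σ τ β)
turn-perp = from-yes (allDir? λ σ → allDir? λ τ → allDir? λ α → allDir? λ β →
  perp? σ τ →-dec (perp? α β →-dec perp? (turn σ τ α) (turn σ τ β)))

⟦_⟧ : ∀ {σ τ} → Perp σ τ → Point → Point
⟦ RU ⟧ (x , y) = (x , y)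
⟦ RD ⟧ (x , y) = (x , - y)
⟦ LU ⟧ (x , y) = (- x , y)
⟦ LD ⟧ (x , y) = (- x , - y)
⟦ UR ⟧ (x , y) = (y , x)
⟦ UL ⟧ (x , y) = (- y , x)
⟦ DR ⟧ (x , y) = (y , - x)
⟦ DL ⟧ (x , y) = (- y , - x)

⟦_⟧⁻¹ : ∀ {σ τ} → Perp σ τ → Point → Point
⟦ RU ⟧⁻¹ (x , y) = (x , y)
⟦ RD ⟧⁻¹ (x , y) = (x , - y)
⟦ LU ⟧⁻¹ (x , y) = (- x , y)
⟦ LD ⟧⁻¹ (x , y) = (- x , - y)
⟦ UR ⟧⁻¹ (x , y) = (y , x)
⟦ UL ⟧⁻¹ (x , y) = (y , - x)
⟦ DR ⟧⁻¹ (x , y) = (- y , x)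
⟦ DL ⟧⁻¹ (x , y) = (- y , - x)

⟦⟧-inverse : ∀ {σ τ} (π : Perp σ τ) p → ⟦ π ⟧ (⟦ π ⟧⁻¹ p) ≡ p
⟦⟧-inverse RU (x , y) = refl
⟦⟧-inverse RD (x , y) = cong (x ,_) (ℤP.neg-involutive y)
⟦⟧-inverse LU (x , y) = cong (_, y) (ℤP.neg-involutive x)
⟦⟧-inverse LD (x , y) = pointwise (ℤP.neg-involutive x) (ℤP.neg-involutive y)
⟦⟧-inverse UR (x , y) = refl
⟦⟧-inverse UL (x , y) = cong (_, y) (ℤP.neg-involutive x)
⟦⟧-inverse DR (x , y) = cong (x ,_) (ℤP.neg-involutive y)
⟦⟧-inverse DL (x , y) = pointwise (ℤP.neg-involutive x) (ℤP.neg-involutive y)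

⟦⟧-⊕ : ∀ {σ τ} (π : Perp σ τ) p q → ⟦ π ⟧ (p ⊕ q) ≡ ⟦ π ⟧ p ⊕ ⟦ π ⟧ q
⟦⟧-⊕ RU (x , y) (x' , y') = refl
⟦⟧-⊕ RD (x , y) (x' , y') = cong (x + x' ,_) (ℤP.neg-distrib-+ y y')
⟦⟧-⊕ LU (x , y) (x' , y') = cong (_, y + y') (ℤP.neg-distrib-+ x x')
⟦⟧-⊕ LD (x , y) (x' , y') = pointwise (ℤP.neg-distrib-+ x x') (ℤP.neg-distrib-+ y y')
⟦⟧-⊕ UR (x , y) (x' , y') = refl
⟦⟧-⊕ UL (x , y) (x' , y') = cong (_, x + x') (ℤP.neg-distrib-+ y y')
⟦⟧-⊕ DR (x , y) (x' , y') = cong (y + y' ,_) (ℤP.neg-distrib-+ x x')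
⟦⟧-⊕ DL (x , y) (x' , y') = pointwise (ℤP.neg-distrib-+ y y') (ℤP.neg-distrib-+ x x')

⟦⟧-vec : ∀ {σ τ} (π : Perp σ τ) δ → ⟦ π ⟧ (vec δ) ≡ vec (turn σ τ δ)
⟦⟧-vec RU = from-yes (allDir? λ δ → ⟦ RU ⟧ (vec δ) ≟P vec (turn Rt Up δ))
⟦⟧-vec RD = from-yes (allDir? λ δ → ⟦ RD ⟧ (vec δ) ≟P vec (turn Rt Dn δ))
⟦⟧-vec LU = from-yes (allDir? λ δ → ⟦ LU ⟧ (vec δ) ≟P vec (turn Lf Up δ))
⟦⟧-vec LD = from-yes (allDir? λ δ → ⟦ LD ⟧ (vec δ) ≟P vec (turn Lf Dn δ))
⟦⟧-vec UR = from-yes (allDir? λ δ → ⟦ UR ⟧ (vec δ) ≟P vec (turn Up Rt δ))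
⟦⟧-vec UL = from-yes (allDir? λ δ → ⟦ UL ⟧ (vec δ) ≟P vec (turn Up Lf δ))
⟦⟧-vec DR = from-yes (allDir? λ δ → ⟦ DR ⟧ (vec δ) ≟P vec (turn Dn Rt δ))
⟦⟧-vec DL = from-yes (allDir? λ δ → ⟦ DL ⟧ (vec δ) ≟P vec (turn Dn Lf δ))

⟦⟧-O : ∀ {σ τ} (π : Perp σ τ) → ⟦ π ⟧ O ≡ O
⟦⟧-O RU = refl
⟦⟧-O RD = refl
⟦⟧-O LU = refl
⟦⟧-O LD = refl
⟦⟧-O UR = refl
⟦⟧-O UL = refl
⟦⟧-O DR = refl
⟦⟧-O DL = refl

⟦⟧-⊖ : ∀ {σ τ} (π : Perp σ τ) p q → ⟦ π ⟧ (p ⊖ q) ≡ ⟦ π ⟧ p ⊖ ⟦ π ⟧ q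
⟦⟧-⊖ π p q = begin
  ⟦ π ⟧ (p ⊖ q)                       ≡⟨ sym (⊕-⊖ _ (⟦ π ⟧ q)) ⟩
  (⟦ π ⟧ (p ⊖ q) ⊕ ⟦ π ⟧ q) ⊖ ⟦ π ⟧ q ≡⟨ cong (_⊖ ⟦ π ⟧ q) (sym (⟦⟧-⊕ π (p ⊖ q) q)) ⟩
  ⟦ π ⟧ ((p ⊖ q) ⊕ q) ⊖ ⟦ π ⟧ q       ≡⟨ cong (λ u → ⟦ π ⟧ u ⊖ ⟦ π ⟧ q) (⊖-⊕ p q) ⟩
  ⟦ π ⟧ p ⊖ ⟦ π ⟧ q                   ∎
  where open ≡-Reasoning

isometry : Point → ∀ {σ τ} → Perp σ τ → Point → Point
isometry v π p = v ⊕ ⟦ π ⟧ p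

isometry-step : ∀ v {σ τ} (π : Perp σ τ) p δ →
                isometry v π (p ⊕ vec δ) ≡ isometry v π p ⊕ vec (turn σ τ δ)
isometry-step v π p δ = begin
  v ⊕ ⟦ π ⟧ (p ⊕ vec δ)            ≡⟨ cong (v ⊕_) (⟦⟧-⊕ π p (vec δ)) ⟩
  v ⊕ (⟦ π ⟧ p ⊕ ⟦ π ⟧ (vec δ))    ≡⟨ cong (λ u → v ⊕ (⟦ π ⟧ p ⊕ u)) (⟦⟧-vec π δ) ⟩
  v ⊕ (⟦ π ⟧ p ⊕ vec (turn _ _ δ)) ≡⟨ sym (⊕-assoc v _ _) ⟩
  (v ⊕ ⟦ π ⟧ p) ⊕ vec (turn _ _ δ) ∎
  where open ≡-Reasoning

edge-subst : ∀ {m p q p' q'} → p ≡ p' → q ≡ q' → Edge m p q → Edge m p' q'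
edge-subst refl refl e = e

edge-sym : ∀ m p q → Edge m p q → Edge m q p
edge-sym zero _ _ ab = ba
edge-sym zero _ _ ba = ab
edge-sym zero _ _ bc = cb
edge-sym zero _ _ cb = bc
edge-sym zero _ _ cd = dc
edge-sym zero _ _ dc = cd
edge-sym zero _ _ da = ad
edge-sym zero _ _ ad = da
edge-sym (suc m) p q (k , e) = k , edge-sym m _ _ e

untranslate : ∀ p q s u → q ⊖ s ≡ (p ⊖ s) ⊕ u → q ≡ p ⊕ u
untranslate p q s u h = begin
  q                 ≡⟨ sym (⊖-⊕ q s) ⟩
  (q ⊖ s) ⊕ s       ≡⟨ cong (_⊕ s) h ⟩
  ((p ⊖ s) ⊕ u) ⊕ s ≡⟨ pointwise (eq (proj₁ p) (proj₁ s) (proj₁ u)) (eq (proj₂ p) (proj₂ s) (proj₂ u)) ⟩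
  p ⊕ u             ∎
  where open ≡-Reasoning
        eq : ∀ (x y z : ℤ) → ((x - y) + z) + y ≡ x + z
        eq = solve-∀

edge-step : ∀ m p q → Edge m p q → Σ Dir λ δ → q ≡ p ⊕ vec δ
edge-step zero _ _ ab = Rt , refl
edge-step zero _ _ ba = Lf , refl
edge-step zero _ _ bc = Up , refl
edge-step zero _ _ cb = Dn , refl
edge-step zero _ _ cd = Lf , refl
edge-step zero _ _ dc = Rt , refl
edge-step zero _ _ da = Dn , refl
edge-step zero _ _ ad = Up , refl
edge-step (suc m) p q (k , e) with edge-step m _ _ e
... | δ , h = δ , untranslate p q (offset m k) (vec δ) h

InRange : ℕ → ℤ → Set
InRange m z = Σ ℕ λ i → z ≡ + i × i ℕ.≤ 3 ℕ.^ m

Digit : ℤ → Set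
Digit z = Σ ℕ λ n → z ≡ + n × n ℕ.≤ 2

t-digits : ∀ k → Digit (proj₁ (t k)) × Digit (proj₂ (t k))
t-digits F.zero = (0 , refl , z≤n) , (0 , refl , z≤n)
t-digits (F.suc F.zero) = (1 , refl , s≤s z≤n) , (0 , refl , z≤n)
t-digits (F.suc (F.suc F.zero)) = (2 , refl , s≤s (s≤s z≤n)) , (0 , refl , z≤n)
t-digits (F.suc (F.suc (F.suc F.zero))) = (2 , refl , s≤s (s≤s z≤n)) , (1 , refl , s≤s z≤n)
t-digits (F.suc (F.suc (F.suc (F.suc F.zero)))) = (2 , refl , s≤s (s≤s z≤n)) , (2 , refl , s≤s (s≤s z≤n))
t-digits (F.suc (F.suc (F.suc (F.suc (F.suc F.zero))))) = (1 , refl , s≤s z≤n) , (2 , refl , s≤s (s≤s z≤n))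
t-digits (F.suc (F.suc (F.suc (F.suc (F.suc (F.suc F.zero)))))) = (0 , refl , z≤n) , (2 , refl , s≤s (s≤s z≤n))
t-digits (F.suc (F.suc (F.suc (F.suc (F.suc (F.suc (F.suc F.zero))))))) = (0 , refl , z≤n) , (1 , refl , s≤s z≤n)

range-step : ∀ m z e → InRange m (z - pow3 m * e) → Digit e → InRange (suc m) z
range-step m z e (i , h , i≤) (g , refl , g≤2) = i ℕ.+ N ℕ.* g , z≡ , bound
  where
  N : ℕ
  N = 3 ℕ.^ m
  z≡ : z ≡ + (i ℕ.+ N ℕ.* g)
  z≡ = begin
    z                                 ≡⟨ solve z (pow3 m * + g) ⟩
    (z - pow3 m * + g) + pow3 m * + g ≡⟨ cong₂ (λ u v → u + v * + g) h (pow3≡ m) ⟩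
    + i + + N * + g                   ≡⟨ cong (λ u → + i + u) (sym (ℤP.pos-* N g)) ⟩
    + i + + (N ℕ.* g)                 ≡⟨ sym (ℤP.pos-+ i (N ℕ.* g)) ⟩
    + (i ℕ.+ N ℕ.* g)                 ∎
    where open ≡-Reasoning
          solve : ∀ (x y : ℤ) → x ≡ (x - y) + y
          solve = solve-∀
  bound : i ℕ.+ N ℕ.* g ℕ.≤ 3 ℕ.^ suc m
  bound = ℕP.≤-trans (ℕP.+-mono-≤ i≤ (ℕP.*-monoʳ-≤ N g≤2))
                     (ℕP.≤-reflexive (cong (N ℕ.+_) (ℕP.*-comm N 2)))

edge-in-box : ∀ m p q → Edge m p q → InRange m (proj₁ p) × InRange m (proj₂ p)
edge-in-box zero _ _ ab = (0 , refl , z≤n) , (0 , refl , z≤n)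
edge-in-box zero _ _ ba = (1 , refl , s≤s z≤n) , (0 , refl , z≤n)
edge-in-box zero _ _ bc = (1 , refl , s≤s z≤n) , (0 , refl , z≤n)
edge-in-box zero _ _ cb = (1 , refl , s≤s z≤n) , (1 , refl , s≤s z≤n)
edge-in-box zero _ _ cd = (1 , refl , s≤s z≤n) , (1 , refl , s≤s z≤n)
edge-in-box zero _ _ dc = (0 , refl , z≤n) , (1 , refl , s≤s z≤n)
edge-in-box zero _ _ da = (0 , refl , z≤n) , (1 , refl , s≤s z≤n)
edge-in-box zero _ _ ad = (0 , refl , z≤n) , (0 , refl , z≤n)
edge-in-box (suc m) p q (k , e) with edge-in-box m _ _ e
... | rx , ry = range-step m (proj₁ p) _ rx (proj₁ (t-digits k)) , range-step m (proj₂ p) _ ry (proj₂ (t-digits k))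

-- § 5. Holes: points strictly inside a removed middle square.

-- z lies strictly inside the middle third of its block of length 3^(j+1):
-- z ≡ 3^j + s (mod 3^(j+1)) with 0 < s < 3^j.
MiddleThird : ℕ → ℤ → Set
MiddleThird j z = Σ ℤ λ α → Σ ℕ λ s →
  z ≡ pow3 (suc j) * α + pow3 j + + s × 1 ℕ.≤ s × s ℕ.< 3 ℕ.^ j

-- p lies strictly inside the removed middle square of a block of Γ_{j+2}.
InHole : ℕ → Point → Set
InHole j p = MiddleThird j (proj₁ p) × MiddleThird j (proj₂ p)

middle-shift : ∀ j z e → MiddleThird j z → MiddleThird j (z + pow3 (suc j) * e)
middle-shift j z e (α , s , refl , 1≤s , s<N) = α + e , s , eq (pow3 (suc j)) α (pow3 j) (+ s) e , 1≤s , s<N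
  where eq : ∀ (K α P s e : ℤ) → K * α + P + s + K * e ≡ K * (α + e) + P + s
        eq = solve-∀

-- Reflection z ↦ -z maps the middle third (N, 2N) to (-2N, -N) ≡ (N, 2N).
middle-neg : ∀ j z → MiddleThird j z → MiddleThird j (- z)
middle-neg j z (α , s , refl , 1≤s , s<N) =
  - α - + 1 , N ℕ.∸ s ,
  (begin
    - (+ 3 * P * α + P + + s)               ≡⟨ eq P α (+ s) ⟩
    + 3 * P * (- α - + 1) + P + (P - + s)   ≡⟨ cong (λ u → + 3 * P * (- α - + 1) + P + u) N-s ⟩
    + 3 * P * (- α - + 1) + P + + (N ℕ.∸ s) ∎) ,
  ℕP.m<n⇒0<n∸m s<N ,
  ℕP.∸-monoʳ-< 1≤s (ℕP.<⇒≤ s<N)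
  where
  open ≡-Reasoning
  N : ℕ
  N = 3 ℕ.^ j
  P : ℤ
  P = pow3 j
  eq : ∀ (P α s : ℤ) → - (+ 3 * P * α + P + s) ≡ + 3 * P * (- α - + 1) + P + (P - s)
  eq = solve-∀
  N-s : P - + s ≡ + (N ℕ.∸ s)
  N-s = trans (cong (_- + s) (pow3≡ j))
              (trans (ℤP.[+m]-[+n]≡m⊖n N s) (ℤP.≤-⊖ (ℕP.<⇒≤ s<N)))

hole-⟦⟧ : ∀ j {σ τ} (π : Perp σ τ) p → InHole j p → InHole j (⟦ π ⟧ p)
hole-⟦⟧ j RU (x , y) (hx , hy) = hx , hy
hole-⟦⟧ j RD (x , y) (hx , hy) = hx , middle-neg j y hy
hole-⟦⟧ j LU (x , y) (hx , hy) = middle-neg j x hx , hy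
hole-⟦⟧ j LD (x , y) (hx , hy) = middle-neg j x hx , middle-neg j y hy
hole-⟦⟧ j UR (x , y) (hx , hy) = hy , hx
hole-⟦⟧ j UL (x , y) (hx , hy) = middle-neg j y hy , hx
hole-⟦⟧ j DR (x , y) (hx , hy) = hy , middle-neg j x hx
hole-⟦⟧ j DL (x , y) (hx , hy) = middle-neg j y hy , middle-neg j x hx

hole-shift : ∀ j p e → InHole j p → InHole j (p ⊕ scale (pow3 (suc j)) e)
hole-shift j p e (hx , hy) = middle-shift j _ (proj₁ e) hx , middle-shift j _ (proj₂ e) hy

private
  nat-pos : ∀ K N s n i g → + K * + n + + N + + s - + N * + g ≡ + i → K ℕ.* n ℕ.+ N ℕ.+ s ≡ i ℕ.+ N ℕ.* g
  nat-pos K N s n i g h = ℤP.+-injective (begin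
    + (K ℕ.* n ℕ.+ N ℕ.+ s) ≡⟨ cong (λ u → u + + N + + s) (ℤP.pos-* K n) ⟩
    + K * + n + + N + + s   ≡⟨ move (+ K * + n + + N + + s) (+ N * + g) (+ i) h ⟩
    + i + + N * + g         ≡⟨ cong (λ u → + i + u) (sym (ℤP.pos-* N g)) ⟩
    + (i ℕ.+ N ℕ.* g)       ∎)
    where open ≡-Reasoning
          move : ∀ x y i → x - y ≡ i → x ≡ i + y
          move x y i h = trans (solve x y) (cong (_+ y) h)
            where solve : ∀ (x y : ℤ) → x ≡ (x - y) + y
                  solve = solve-∀

  nat-neg : ∀ K N s n i g → + K * -[1+ n ] + + N + + s - + N * + g ≡ + i → N ℕ.+ s ≡ i ℕ.+ N ℕ.* g ℕ.+ K ℕ.* suc n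
  nat-neg K N s n i g h = ℤP.+-injective (begin
    + N + + s                         ≡⟨ move (+ K) (+ suc n) (+ N) (+ s) (+ N * + g) (+ i) h ⟩
    + i + + N * + g + + K * + suc n   ≡⟨ cong₂ (λ u v → + i + u + v) (sym (ℤP.pos-* N g)) (sym (ℤP.pos-* K (suc n))) ⟩
    + (i ℕ.+ N ℕ.* g ℕ.+ K ℕ.* suc n) ∎)
    where open ≡-Reasoning
          move : ∀ K m N s y i → K * (- m) + N + s - y ≡ i → N + s ≡ i + y + K * m
          move K m N s y i h = trans (solve K m N s y) (cong (λ u → u + y + K * m) h)
            where solve : ∀ (K m N s y : ℤ) → N + s ≡ (K * (- m) + N + s - y) + y + K * m
                  solve = solve-∀

  -- The three ways a middle-third point could land in an outer third
  -- [0, N] or [2N, 3N] of its block, each absurd.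
  low-outer : ∀ N s n i → 1 ℕ.≤ s → i ℕ.≤ N → 3 ℕ.* N ℕ.* n ℕ.+ N ℕ.+ s ≢ i ℕ.+ N ℕ.* 0
  low-outer N s n i 1≤s i≤N h = ℕP.<-irrefl refl (begin-strict
    N                           <⟨ ℕP.m<m+n N 1≤s ⟩
    N ℕ.+ s                     ≤⟨ ℕP.m≤n+m (N ℕ.+ s) (3 ℕ.* N ℕ.* n) ⟩
    3 ℕ.* N ℕ.* n ℕ.+ (N ℕ.+ s) ≡⟨ sym (ℕP.+-assoc (3 ℕ.* N ℕ.* n) N s) ⟩
    3 ℕ.* N ℕ.* n ℕ.+ N ℕ.+ s   ≡⟨ h ⟩
    i ℕ.+ N ℕ.* 0               ≡⟨ cong (i ℕ.+_) (ℕP.*-zeroʳ N) ⟩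
    i ℕ.+ 0                     ≡⟨ ℕP.+-identityʳ i ⟩
    i                           ≤⟨ i≤N ⟩
    N                           ∎)
    where open ℕP.≤-Reasoning

  high-outer : ∀ N s n i → 1 ℕ.≤ s → s ℕ.< N → i ℕ.≤ N → 3 ℕ.* N ℕ.* n ℕ.+ N ℕ.+ s ≢ i ℕ.+ N ℕ.* 2
  high-outer N s zero i _ s<N i≤N h = ℕP.<-irrefl refl (begin-strict
    N       ≤⟨ ℕP.m≤n+m N i ⟩
    i ℕ.+ N ≡⟨ ℕP.+-cancelʳ-≡ N _ _ (trans (eq₁ i N) (trans (sym h) (eq₂ N s))) ⟩
    s       <⟨ s<N ⟩
    N       ∎)
    where open ℕP.≤-Reasoning
          eq₁ : ∀ i N → i ℕ.+ N ℕ.+ N ≡ i ℕ.+ N ℕ.* 2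
          eq₁ = ℕS.solve-∀
          eq₂ : ∀ N s → 3 ℕ.* N ℕ.* 0 ℕ.+ N ℕ.+ s ≡ s ℕ.+ N
          eq₂ = ℕS.solve-∀
  high-outer N s (suc n) i 1≤s _ i≤N h = ℕP.<-irrefl refl (begin-strict
    i ℕ.+ N ℕ.* 2                 ≤⟨ ℕP.+-monoˡ-≤ (N ℕ.* 2) i≤N ⟩
    N ℕ.+ N ℕ.* 2                 ≡⟨ eq N ⟩
    3 ℕ.* N ℕ.* 1                 ≤⟨ ℕP.*-monoʳ-≤ (3 ℕ.* N) (s≤s z≤n) ⟩
    3 ℕ.* N ℕ.* suc n             ≤⟨ ℕP.m≤m+n _ N ⟩
    3 ℕ.* N ℕ.* suc n ℕ.+ N       <⟨ ℕP.m<m+n _ 1≤s ⟩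
    3 ℕ.* N ℕ.* suc n ℕ.+ N ℕ.+ s ≡⟨ h ⟩
    i ℕ.+ N ℕ.* 2                 ∎)
    where open ℕP.≤-Reasoning
          eq : ∀ N → N ℕ.+ N ℕ.* 2 ≡ 3 ℕ.* N ℕ.* 1
          eq = ℕS.solve-∀

  negative-outer : ∀ N s n i g → s ℕ.< N → N ℕ.+ s ≢ i ℕ.+ N ℕ.* g ℕ.+ 3 ℕ.* N ℕ.* suc n
  negative-outer N s n i g s<N h = ℕP.<-irrefl refl (begin-strict
    N ℕ.+ s                             <⟨ ℕP.+-monoʳ-< N s<N ⟩
    N ℕ.+ N                             ≤⟨ ℕP.m≤m+n (N ℕ.+ N) N ⟩
    N ℕ.+ N ℕ.+ N                       ≡⟨ eq N ⟩
    3 ℕ.* N ℕ.* 1                       ≤⟨ ℕP.*-monoʳ-≤ (3 ℕ.* N) (s≤s z≤n) ⟩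
    3 ℕ.* N ℕ.* suc n                   ≤⟨ ℕP.m≤n+m _ (i ℕ.+ N ℕ.* g) ⟩
    i ℕ.+ N ℕ.* g ℕ.+ 3 ℕ.* N ℕ.* suc n ≡⟨ sym h ⟩
    N ℕ.+ s                             ∎)
    where open ℕP.≤-Reasoning
          eq : ∀ N → N ℕ.+ N ℕ.+ N ≡ 3 ℕ.* N ℕ.* 1
          eq = ℕS.solve-∀

middle-avoids : ∀ j z e i → MiddleThird j z → z - pow3 j * e ≡ + i → i ℕ.≤ 3 ℕ.^ j →
                e ≡ + 0 ⊎ e ≡ + 2 → ⊥
middle-avoids j z e i (α , s , refl , 1≤s , s<N) h i≤N e∈ = outer α e∈ h'
  where
  N : ℕ
  N = 3 ℕ.^ j
  h' : + (3 ℕ.* N) * α + + N + + s - + N * e ≡ + i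
  h' = trans (cong₂ (λ K P → K * α + P + + s - P * e) (sym (pow3≡ (suc j))) (sym (pow3≡ j))) h
  outer : ∀ α → e ≡ + 0 ⊎ e ≡ + 2 → + (3 ℕ.* N) * α + + N + + s - + N * e ≡ + i → ⊥
  outer (+ n) (inj₁ refl) h = low-outer N s n i 1≤s i≤N (nat-pos (3 ℕ.* N) N s n i 0 h)
  outer (+ n) (inj₂ refl) h = high-outer N s n i 1≤s s<N i≤N (nat-pos (3 ℕ.* N) N s n i 2 h)
  outer -[1+ n ] (inj₁ refl) h = negative-outer N s n i 0 s<N (nat-neg (3 ℕ.* N) N s n i 0 h)
  outer -[1+ n ] (inj₂ refl) h = negative-outer N s n i 2 s<N (nat-neg (3 ℕ.* N) N s n i 2 h)

Outer : ℤ → Set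
Outer e = e ≡ + 0 ⊎ e ≡ + 2

-- Every position t_k other than the (omitted) middle one lies in an outer
-- column or an outer row.
t-outer : ∀ k → Outer (proj₁ (t k)) ⊎ Outer (proj₂ (t k))
t-outer = from-yes (FP.all? λ k → outer? (proj₁ (t k)) ⊎-dec outer? (proj₂ (t k)))
  where outer? : ∀ e → Dec (Outer e)
        outer? e = (e ℤP.≟ + 0) ⊎-dec (e ℤP.≟ + 2)

private
  -- Hole points of scale j are not on edges of levels ≤ j: those lie in [0, 3^j]².
  hole-below : ∀ j M z z' → M ℕ.≤ j → Edge M z z' → InHole j z → ⊥
  hole-below j M z z' M≤j e (hx , _) with edge-in-box M z z' e
  ... | (i , zi , i≤) , _ =
    middle-avoids j (proj₁ z) (+ 0) i hx (trans (no-shift (proj₁ z) (pow3 j)) zi)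
      (ℕP.≤-trans i≤ (ℕP.^-monoʳ-≤ 3 M≤j)) (inj₁ refl)
    where no-shift : ∀ (x P : ℤ) → x - P * + 0 ≡ x
          no-shift = solve-∀

  -- At level j+1, every copy lies in an outer column or row of the 3×3 block.
  hole-at : ∀ j z z' → Edge (suc j) z z' → InHole j z → ⊥
  hole-at j z z' (k , e) (hx , hy) with edge-in-box j _ _ e | t-outer k
  ... | (i , zi , i≤) , _ | inj₁ out = middle-avoids j (proj₁ z) _ i hx zi i≤ out
  ... | _ , (i , zi , i≤) | inj₂ out = middle-avoids j (proj₂ z) _ i hy zi i≤ out

  coarse-shift : ∀ j o z k → z ⊖ offset (suc j ℕ.+ o) k ≡ z ⊕ scale (pow3 (suc j)) (scale (- pow3 o) (t k))
  coarse-shift j o z k = pointwise (eq (proj₁ z) (proj₁ (t k))) (eq (proj₂ z) (proj₂ (t k)))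
    where eq : ∀ x u → x - pow3 (suc j ℕ.+ o) * u ≡ x + pow3 (suc j) * (- pow3 o * u)
          eq x u = trans (cong (λ P → x - P * u) (pow3-+ (suc j) o)) (solve x (pow3 (suc j)) (pow3 o) u)
            where solve : ∀ (x K Q u : ℤ) → x - K * Q * u ≡ x + K * (- Q * u)
                  solve = solve-∀

hole-not-on-edge : ∀ j M z z' → Edge M z z' → InHole j z → ⊥
hole-not-on-edge j zero z z' e h = hole-below j zero z z' z≤n e h
hole-not-on-edge j (suc M) z z' e h with ℕP.<-cmp M j
... | tri< M<j _ _ = hole-below j (suc M) z z' M<j e h
... | tri≈ _ refl _ = hole-at j z z' e h
hole-not-on-edge j (suc M) z z' (k , e) h | tri> _ _ j<M with ℕP.m≤n⇒∃[o]m+o≡n j<M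
... | o , refl = hole-not-on-edge j M _ (z' ⊖ offset M k) e
                   (subst (InHole j) (sym (coarse-shift j o z k)) (hole-shift j z _ h))

edge-grow : ∀ w m u v → Edge m (u ⊕ root w m) (v ⊕ root w m) →
            Edge (suc m) (u ⊕ root w (suc m)) (v ⊕ root w (suc m))
edge-grow w m u v e = proj₂ w m , edge-subst (back u) (back v) e
  where
  s : Point
  s = offset m (proj₂ w m)
  back : ∀ u → u ⊕ root w m ≡ (u ⊕ root w (suc m)) ⊖ s
  back u = sym (trans (cong (_⊖ s) (sym (⊕-assoc u (root w m) s))) (⊕-⊖ (u ⊕ root w m) s))

edge-growⁿ : ∀ w n m u v → Edge m (u ⊕ root w m) (v ⊕ root w m) →
             Edge (n ℕ.+ m) (u ⊕ root w (n ℕ.+ m)) (v ⊕ root w (n ℕ.+ m))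
edge-growⁿ w zero    m u v e = e
edge-growⁿ w (suc n) m u v e = edge-grow w (n ℕ.+ m) u v (edge-growⁿ w n m u v e)

root-shift : ∀ w J n → Σ Point λ δ → root w (n ℕ.+ J) ≡ root w J ⊕ scale (pow3 J) δ
root-shift w J zero = O , pointwise (solve (proj₁ (root w J)) (pow3 J)) (solve (proj₂ (root w J)) (pow3 J))
  where solve : ∀ (r P : ℤ) → r ≡ r + P * + 0
        solve = solve-∀
root-shift w J (suc n) with root-shift w J n
... | δ , h = δ ⊕ scale (pow3 n) (t k) , (begin
  root w (n ℕ.+ J) ⊕ scale (pow3 (n ℕ.+ J)) (t k)
    ≡⟨ cong₂ (λ r P → r ⊕ scale P (t k)) h (pow3-+ n J) ⟩
  (root w J ⊕ scale (pow3 J) δ) ⊕ scale (pow3 n * pow3 J) (t k)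
    ≡⟨ pointwise (solve (proj₁ (root w J)) (pow3 J) (proj₁ δ) (pow3 n) (proj₁ (t k)))
                 (solve (proj₂ (root w J)) (pow3 J) (proj₂ δ) (pow3 n) (proj₂ (t k))) ⟩
  root w J ⊕ scale (pow3 J) (δ ⊕ scale (pow3 n) (t k)) ∎)
  where
  open ≡-Reasoning
  k : X
  k = proj₂ w (n ℕ.+ J)
  solve : ∀ (r P δ Q u : ℤ) → r + P * δ + Q * P * u ≡ r + P * (δ + Q * u)
  solve = solve-∀

hole-not-vertex : ∀ w j q → InHole j (q ⊕ root w (suc j)) → ¬ Vertex w q
hole-not-vertex w j q h (z , m , e) = hole-not-on-edge j L _ (z ⊕ root w L) e' h'
  where
  L : ℕ
  L = m ℕ.+ suc j
  e' : Edge L (q ⊕ root w L) (z ⊕ root w L)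
  e' = subst (λ M → Edge M (q ⊕ root w M) (z ⊕ root w M)) (ℕP.+-comm (suc j) m)
             (edge-growⁿ w (suc j) m q z e)
  δ : Point
  δ = proj₁ (root-shift w (suc j) m)
  h' : InHole j (q ⊕ root w L)
  h' = subst (InHole j) (sym (trans (cong (q ⊕_) (proj₂ (root-shift w (suc j) m))) (sym (⊕-assoc q _ _))))
             (hole-shift j _ δ h)

-- § 7. The unit cells of Γ_{m+1} and their connectivity.

-- Cell m p : p is the lower-left corner of one of the 8^m unit cells of Γ_{m+1}.
Cell : ℕ → Point → Set
Cell zero    p = p ≡ O
Cell (suc m) p = Σ X λ k → Cell m (p ⊖ offset m k)

one : Point
one = (+ 1 , + 1)

Square : (Point → Point → Set) → Point → Set
Square E p = E p (p ⊕ vec Rt) × E p (p ⊕ vec Up) × E (p ⊕ vec Rt) (p ⊕ one) × E (p ⊕ vec Up) (p ⊕ one)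

commute : ∀ p s u → (p ⊖ s) ⊕ u ≡ (p ⊕ u) ⊖ s
commute p s u = pointwise (eq (proj₁ p) (proj₁ s) (proj₁ u)) (eq (proj₂ p) (proj₂ s) (proj₂ u))
  where eq : ∀ (x s u : ℤ) → x - s + u ≡ x + u - s
        eq = solve-∀

cell-square : ∀ m p → Cell m p → Square (Edge m) p
cell-square zero    p refl = ab , ad , bc , dc
cell-square (suc m) p (k , cl) with cell-square m _ cl
... | e₁ , e₂ , e₃ , e₄ =
  (k , edge-subst refl (commute p s (vec Rt)) e₁) ,
  (k , edge-subst refl (commute p s (vec Up)) e₂) ,
  (k , edge-subst (commute p s (vec Rt)) (commute p s one) e₃) ,
  (k , edge-subst (commute p s (vec Up)) (commute p s one) e₄)
  where s : Point
        s = offset m k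

cell-lift : ∀ m k p → Cell m p → Cell (suc m) (p ⊕ offset m k)
cell-lift m k p cl = k , subst (Cell m) (sym (⊕-⊖ p (offset m k))) cl

data Chain (m : ℕ) : Point → Point → Set where
  here : ∀ {p} → Chain m p p
  next : ∀ {p q r} δ → Chain m p q → Cell m q → Cell m r → r ≡ q ⊕ vec δ → Chain m p r

chain-subst : ∀ {m p p' q q'} → p ≡ p' → q ≡ q' → Chain m p q → Chain m p' q'
chain-subst refl refl ch = ch

chain-trans : ∀ {m p q r} → Chain m p q → Chain m q r → Chain m p r
chain-trans ch here               = ch
chain-trans ch (next δ ch' x y eq) = next δ (chain-trans ch ch') x y eq

chain-sym : ∀ {m p q} → Chain m p q → Chain m q p
chain-sym here = here
chain-sym {m} (next {q = q} {r} δ ch x y refl) = chain-trans (next (opp δ) here y x back) (chain-sym ch)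
  where back : q ≡ (q ⊕ vec δ) ⊕ vec (opp δ)
        back = sym (trans (⊕-assoc q (vec δ) (vec (opp δ)))
                     (trans (cong (q ⊕_) (vec-opp δ)) (⊕-identityʳ q)))

chain-lift : ∀ {m p q} k → Chain m p q → Chain (suc m) (p ⊕ offset m k) (q ⊕ offset m k)
chain-lift k here = here
chain-lift {m} k (next {q = q} δ ch x y refl) =
  next δ (chain-lift k ch) (cell-lift m k _ x) (cell-lift m k _ y) (translate q (offset m k) (vec δ))
  where translate : ∀ q s u → (q ⊕ u) ⊕ s ≡ (q ⊕ s) ⊕ u
        translate q s u = trans (⊕-assoc q u s) (trans (cong (q ⊕_) (⊕-comm u s)) (sym (⊕-assoc q s u)))

origin-cell : ∀ m → Cell m O
origin-cell zero    = refl
origin-cell (suc m) = F.zero , subst (Cell m) (sym (pointwise (eq (pow3 m)) (eq (pow3 m)))) (origin-cell m)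
  where eq : ∀ (P : ℤ) → + 0 - P * + 0 ≡ + 0
        eq = solve-∀

bottom-right : ℕ → Point
bottom-right m = (pow3 m - + 1 , + 0)

top-left : ℕ → Point
top-left m = (+ 0 , pow3 m - + 1)

private
  last : ∀ (P : ℤ) → + 3 * P - + 1 - P * + 2 ≡ P - + 1
  last = solve-∀
  first : ∀ (P : ℤ) → + 0 - P * + 0 ≡ + 0
  first = solve-∀

bottom-right-cell : ∀ m → Cell m (bottom-right m)
bottom-right-cell zero    = refl
bottom-right-cell (suc m) = F.suc (F.suc F.zero) ,
  subst (Cell m) (sym (pointwise (last (pow3 m)) (first (pow3 m)))) (bottom-right-cell m)

top-left-cell : ∀ m → Cell m (top-left m)
top-left-cell zero    = refl
top-left-cell (suc m) = F.suc (F.suc (F.suc (F.suc (F.suc (F.suc F.zero))))) ,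
  subst (Cell m) (sym (pointwise (first (pow3 m)) (last (pow3 m)))) (top-left-cell m)

copy-origin : ∀ m k → Cell (suc m) (O ⊕ offset m k)
copy-origin m k = cell-lift m k O (origin-cell m)

module _ (m : ℕ) (from-origin : ∀ p → Cell m p → Chain m O p) where
  Joined : X → X → Set
  Joined k k' = Chain (suc m) (O ⊕ offset m k) (O ⊕ offset m k')

  -- The copies in horizontally (vertically) adjacent positions k, k' are joined
  -- through the bottom-right (top-left) cell of copy k.
  link : ∀ k k' p δ → Cell m p → O ⊕ offset m k' ≡ (p ⊕ offset m k) ⊕ vec δ → Joined k k'
  link k k' p δ cl eq = chain-trans (chain-lift k (from-origin p cl))
                                    (next δ here (cell-lift m k p cl) (copy-origin m k') eq)

  link-Rt : ∀ k k' → t k' ≡ t k ⊕ vec Rt → Joined k k'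
  link-Rt k k' tk' = link k k' (bottom-right m) Rt (bottom-right-cell m) (begin
    O ⊕ offset m k'                        ≡⟨ cong (λ u → O ⊕ scale P u) tk' ⟩
    O ⊕ scale P (t k ⊕ vec Rt)             ≡⟨ pointwise (eq₁ P (proj₁ (t k))) (eq₀ P (proj₂ (t k))) ⟩
    (bottom-right m ⊕ offset m k) ⊕ vec Rt ∎)
    where open ≡-Reasoning
          P : ℤ
          P = pow3 m
          eq₁ : ∀ (P u : ℤ) → + 0 + P * (u + + 1) ≡ P - + 1 + P * u + + 1
          eq₁ = solve-∀
          eq₀ : ∀ (P u : ℤ) → + 0 + P * (u + + 0) ≡ + 0 + P * u + + 0
          eq₀ = solve-∀

  link-Up : ∀ k k' → t k' ≡ t k ⊕ vec Up → Joined k k'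
  link-Up k k' tk' = link k k' (top-left m) Up (top-left-cell m) (begin
    O ⊕ offset m k'                    ≡⟨ cong (λ u → O ⊕ scale P u) tk' ⟩
    O ⊕ scale P (t k ⊕ vec Up)         ≡⟨ pointwise (eq₀ P (proj₁ (t k))) (eq₁ P (proj₂ (t k))) ⟩
    (top-left m ⊕ offset m k) ⊕ vec Up ∎)
    where open ≡-Reasoning
          P : ℤ
          P = pow3 m
          eq₁ : ∀ (P u : ℤ) → + 0 + P * (u + + 1) ≡ P - + 1 + P * u + + 1
          eq₁ = solve-∀
          eq₀ : ∀ (P u : ℤ) → + 0 + P * (u + + 0) ≡ + 0 + P * u + + 0
          eq₀ = solve-∀

  r01 : Joined (F.# 0) (F.# 1)
  r01 = link-Rt (F.# 0) (F.# 1) refl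
  r12 : Joined (F.# 1) (F.# 2)
  r12 = link-Rt (F.# 1) (F.# 2) refl
  u23 : Joined (F.# 2) (F.# 3)
  u23 = link-Up (F.# 2) (F.# 3) refl
  u07 : Joined (F.# 0) (F.# 7)
  u07 = link-Up (F.# 0) (F.# 7) refl
  u76 : Joined (F.# 7) (F.# 6)
  u76 = link-Up (F.# 7) (F.# 6) refl
  r65 : Joined (F.# 6) (F.# 5)
  r65 = link-Rt (F.# 6) (F.# 5) refl
  r54 : Joined (F.# 5) (F.# 4)
  r54 = link-Rt (F.# 5) (F.# 4) refl

  around : ∀ k → Joined F.zero k
  around F.zero = here
  around (F.suc F.zero) = r01
  around (F.suc (F.suc F.zero)) = chain-trans r01 r12
  around (F.suc (F.suc (F.suc F.zero))) = chain-trans r01 (chain-trans r12 u23)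
  around (F.suc (F.suc (F.suc (F.suc F.zero)))) = chain-trans u07 (chain-trans u76 (chain-trans r65 r54))
  around (F.suc (F.suc (F.suc (F.suc (F.suc F.zero))))) = chain-trans u07 (chain-trans u76 r65)
  around (F.suc (F.suc (F.suc (F.suc (F.suc (F.suc F.zero)))))) = chain-trans u07 u76
  around (F.suc (F.suc (F.suc (F.suc (F.suc (F.suc (F.suc F.zero))))))) = u07

from-origin : ∀ m p → Cell m p → Chain m O p
from-origin zero    p refl      = here
from-origin (suc m) p (k , cl)  =
  chain-trans (chain-subst base refl (around m (from-origin m) k))
              (chain-subst refl (⊖-⊕ p (offset m k)) (chain-lift k (from-origin m _ cl)))
  where base : O ⊕ offset m F.zero ≡ O
        base = pointwise (eq (pow3 m)) (eq (pow3 m))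
          where eq : ∀ (P : ℤ) → + 0 + P * + 0 ≡ + 0
                eq = solve-∀

-- § 8. Rigidity of injective unit-step maps.

private
  regroup : ∀ z p q r s → p ⊕ q ≡ r ⊕ s → (z ⊕ p) ⊕ q ≡ (z ⊕ r) ⊕ s
  regroup z p q r s h = trans (⊕-assoc z p q) (trans (cong (z ⊕_) h) (sym (⊕-assoc z r s)))

  merge : ∀ z p q → (z ⊕ p) ⊕ q ≡ z ⊕ (p ⊕ q)
  merge = ⊕-assoc

  cancel : ∀ z p q → p ⊕ q ≡ O → (z ⊕ p) ⊕ q ≡ z
  cancel z p q h = trans (⊕-assoc z p q) (trans (cong (z ⊕_) h) (⊕-identityʳ z))

  perp-facts : ∀ α β → Perp α β →
               (vec (opp β) ≢ vec α) × (vec (opp β) ≢ vec β) × (vec α ⊕ vec (opp β) ≢ O)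
  perp-facts = from-yes (allDir? λ α → allDir? λ β → perp? α β →-dec
    (¬? (vec (opp β) ≟P vec α) ×-dec (¬? (vec (opp β) ≟P vec β) ×-dec ¬? ((vec α ⊕ vec (opp β)) ≟P O))))

module UnitStepMap {E : Point → Point → Set} (E-sym : ∀ {p q} → E p q → E q p) (F : Point → Point)
  (F-step : ∀ {p q} → E p q → Σ Dir λ δ → F q ≡ F p ⊕ vec δ)
  (F-inj : ∀ {p p' q q'} → E p p' → E q q' → F p ≡ F q → p ≡ q) where

  ImageSquare : Point → Set
  ImageSquare u = Σ Dir λ σ → Σ Dir λ τ → Perp σ τ ×
    F (u ⊕ vec Rt) ≡ F u ⊕ vec σ × F (u ⊕ vec Up) ≡ F u ⊕ vec τ × F (u ⊕ one) ≡ (F u ⊕ vec σ) ⊕ vec τ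

  -- The image of a unit square is a unit square: injectivity excludes the
  -- degenerate closed walks of length four.
  square-image : ∀ u → Square E u → ImageSquare u
  square-image u (e₁ , e₂ , e₃ , e₄) = σ , τ , perp , h₁ , h₂ , F-one
    where
    σ τ δ δ' : Dir
    σ = proj₁ (F-step e₁)
    τ = proj₁ (F-step e₂)
    δ = proj₁ (F-step e₃)
    δ' = proj₁ (F-step e₄)
    h₁ : F (u ⊕ vec Rt) ≡ F u ⊕ vec σ
    h₁ = proj₂ (F-step e₁)
    h₂ : F (u ⊕ vec Up) ≡ F u ⊕ vec τ
    h₂ = proj₂ (F-step e₂)
    h₃ : F (u ⊕ one) ≡ (F u ⊕ vec σ) ⊕ vec δ
    h₃ = trans (proj₂ (F-step e₃)) (cong (_⊕ vec δ) h₁)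
    h₄ : F (u ⊕ one) ≡ (F u ⊕ vec τ) ⊕ vec δ'
    h₄ = trans (proj₂ (F-step e₄)) (cong (_⊕ vec δ') h₂)
    σ≢τ : σ ≢ τ
    σ≢τ σ≡τ with ⊕-cancelˡ u _ _ (F-inj e₃ e₄ (trans h₁ (trans (cong (λ x → F u ⊕ vec x) σ≡τ) (sym h₂))))
    ... | ()
    nonzero : vec σ ⊕ vec δ ≢ O
    nonzero eq with ⊕-cancelˡ u _ _ (trans (F-inj (E-sym e₃) e₁
                      (trans h₃ (trans (merge (F u) _ _) (trans (cong (F u ⊕_) eq) (⊕-identityʳ (F u))))))
                    (sym (⊕-identityʳ u)))
    ... | ()
    δ≡τ : δ ≡ τ
    δ≡τ with unitPair σ δ τ δ' (⊕-cancelˡ (F u) _ _ (trans (sym (merge (F u) _ _)) (trans (sym h₃) (trans h₄ (merge (F u) _ _)))))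
    ... | inj₁ (σ≡τ , _)          = ⊥-elim (σ≢τ σ≡τ)
    ... | inj₂ (inj₁ (_ , δ≡τ))   = δ≡τ
    ... | inj₂ (inj₂ δ≡σ̄)         = ⊥-elim (nonzero (trans (cong (λ x → vec σ ⊕ vec x) δ≡σ̄) (vec-opp σ)))
    perp : Perp σ τ
    perp = distinct⇒perp σ τ σ≢τ λ τ≡σ̄ → nonzero (trans (cong (λ x → vec σ ⊕ vec x) (trans δ≡τ τ≡σ̄)) (vec-opp σ))
    F-one : F (u ⊕ one) ≡ (F u ⊕ vec σ) ⊕ vec τ
    F-one = trans h₃ (cong (λ x → (F u ⊕ vec σ) ⊕ vec x) δ≡τ)

  -- Agreement of F with a lattice isometry A spreads from cell to cell.
  module Agreement (A : Point → Point) {σ τ} (π : Perp σ τ)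
    (A-step : ∀ p δ → A (p ⊕ vec δ) ≡ A p ⊕ vec (turn σ τ δ)) where

    Agree : Point → Set
    Agree p = F p ≡ A p

    agree-subst : ∀ {p q} → p ≡ q → Agree p → Agree q
    agree-subst refl g = g

    -- Given the square u, u+α, u+β (α ⊥ β) on which F agrees with A, F also
    -- agrees with A on the square on the other side of the side (u, u+α).
    across : ∀ u α β → Perp α β → ∀ {z} →
      E u (u ⊕ vec (opp β)) → E (u ⊕ vec α) ((u ⊕ vec α) ⊕ vec (opp β)) →
      E (u ⊕ vec (opp β)) ((u ⊕ vec α) ⊕ vec (opp β)) → E (u ⊕ vec β) z →
      Agree u → Agree (u ⊕ vec α) → Agree (u ⊕ vec β) →
      Agree (u ⊕ vec (opp β)) × Agree ((u ⊕ vec α) ⊕ vec (opp β))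
    across u α β αβ eu ew e' eβ gu gw gβ = agree-u' , agree-w'
      where
      w : Point
      w = u ⊕ vec α
      α' β' : Dir
      α' = turn σ τ α
      β' = turn σ τ β
      facts : (vec (opp β) ≢ vec α) × (vec (opp β) ≢ vec β) × (vec α ⊕ vec (opp β) ≢ O)
      facts = perp-facts α β αβ
      δ₁ δ₂ δ₃ : Dir
      δ₁ = proj₁ (F-step eu)
      δ₂ = proj₁ (F-step ew)
      δ₃ = proj₁ (F-step e')
      Fu' : F (u ⊕ vec (opp β)) ≡ A u ⊕ vec δ₁
      Fu' = trans (proj₂ (F-step eu)) (cong (_⊕ vec δ₁) gu)
      Fw : F w ≡ A u ⊕ vec α'
      Fw = trans gw (A-step u α)
      Fw' : F (w ⊕ vec (opp β)) ≡ (A u ⊕ vec α') ⊕ vec δ₂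
      Fw' = trans (proj₂ (F-step ew)) (cong (_⊕ vec δ₂) Fw)
      δ₁≢α' : δ₁ ≢ α'
      δ₁≢α' eq = proj₁ facts (⊕-cancelˡ u _ _ (F-inj (E-sym eu) ew
                   (trans Fu' (trans (cong (λ x → A u ⊕ vec x) eq) (sym Fw)))))
      δ₁≢β' : δ₁ ≢ β'
      δ₁≢β' eq = proj₁ (proj₂ facts) (⊕-cancelˡ u _ _ (F-inj (E-sym eu) eβ
                   (trans Fu' (trans (cong (λ x → A u ⊕ vec x) eq) (sym (trans gβ (A-step u β)))))))
      δ₂≢ᾱ' : δ₂ ≢ opp α'
      δ₂≢ᾱ' eq = proj₂ (proj₂ facts) (⊕-cancelˡ u _ _ (trans (sym (merge u _ _))
                   (trans (F-inj (E-sym ew) eu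
                     (trans Fw' (trans (cong (λ x → (A u ⊕ vec α') ⊕ vec x) eq)
                       (trans (cancel (A u) _ _ (vec-opp α')) (sym gu)))))
                     (sym (⊕-identityʳ u)))))
      closed : δ₂ ≡ δ₁ × δ₁ ≡ opp β'
      closed = square-closes α' β' δ₁ δ₂ δ₃ (turn-perp σ τ α β π αβ)
                 (⊕-cancelˡ (A u) _ _ (trans (sym (merge (A u) _ _))
                   (trans (sym Fw') (trans (proj₂ (F-step e')) (trans (cong (_⊕ vec δ₃) Fu') (merge (A u) _ _))))))
                 δ₁≢α' δ₁≢β' δ₂≢ᾱ'
      δ₁≡β̄' : δ₁ ≡ turn σ τ (opp β)
      δ₁≡β̄' = trans (proj₂ closed) (sym (turn-opp σ τ β))
      agree-u' : Agree (u ⊕ vec (opp β))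
      agree-u' = trans Fu' (trans (cong (λ x → A u ⊕ vec x) δ₁≡β̄') (sym (A-step u (opp β))))
      agree-w' : Agree (w ⊕ vec (opp β))
      agree-w' = trans (proj₂ (F-step ew))
                   (trans (cong₂ (λ p x → p ⊕ vec x) gw (trans (proj₁ closed) δ₁≡β̄')) (sym (A-step w (opp β))))

    AgreeCell : Point → Set
    AgreeCell p = Agree p × Agree (p ⊕ vec Rt) × Agree (p ⊕ vec Up) × Agree (p ⊕ one)

    step : ∀ p δ → Square E p → Square E (p ⊕ vec δ) → AgreeCell p → AgreeCell (p ⊕ vec δ)
    step p Rt (e₁ , _) (f₁ , _ , f₃ , f₄) (g₀ , gR , gU , g₁) =
      gR , proj₁ new , agree-subst (sym up) g₁ , agree-subst corner (proj₂ new)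
      where
      q : Point
      q = p ⊕ vec Rt
      up : q ⊕ vec Up ≡ p ⊕ one
      up = merge p _ _
      corner : (q ⊕ vec Up) ⊕ vec Rt ≡ q ⊕ one
      corner = merge q _ _
      back : q ⊕ vec Lf ≡ p
      back = cancel p _ _ refl
      new : Agree (q ⊕ vec Rt) × Agree ((q ⊕ vec Up) ⊕ vec Rt)
      new = across q Up Lf UL f₁ (subst₂ E refl (sym corner) f₄) (subst₂ E refl (sym corner) f₃)
              (subst₂ E (sym back) refl e₁) gR (agree-subst (sym up) g₁) (agree-subst (sym back) g₀)
    step p Up (_ , e₂ , _) (_ , f₂ , f₃ , f₄) (g₀ , gR , gU , g₁) =
      gU , agree-subst (sym rt) g₁ , proj₁ new , agree-subst corner (proj₂ new)
      where
      q : Point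
      q = p ⊕ vec Up
      rt : q ⊕ vec Rt ≡ p ⊕ one
      rt = merge p _ _
      corner : (q ⊕ vec Rt) ⊕ vec Up ≡ q ⊕ one
      corner = merge q _ _
      back : q ⊕ vec Dn ≡ p
      back = cancel p _ _ refl
      new : Agree (q ⊕ vec Up) × Agree ((q ⊕ vec Rt) ⊕ vec Up)
      new = across q Rt Dn RD f₂ (subst₂ E refl (sym corner) f₃) (subst₂ E refl (sym corner) f₄)
              (subst₂ E (sym back) refl e₂) gU (agree-subst (sym rt) g₁) (agree-subst (sym back) g₀)
    step p Lf (e₁ , _) (f₁ , f₂ , _ , f₄) (g₀ , gR , gU , g₁) =
      proj₁ new , agree-subst (sym back) g₀ , agree-subst (sym side) (proj₂ new) , agree-subst (sym corner) gU
      where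
      q : Point
      q = p ⊕ vec Lf
      back : q ⊕ vec Rt ≡ p
      back = cancel p _ _ refl
      corner : q ⊕ one ≡ p ⊕ vec Up
      corner = merge p _ _
      side : q ⊕ vec Up ≡ (p ⊕ vec Up) ⊕ vec Lf
      side = regroup p _ _ _ _ refl
      new : Agree (p ⊕ vec Lf) × Agree ((p ⊕ vec Up) ⊕ vec Lf)
      new = across p Up Rt UR (subst₂ E back refl (E-sym f₁)) (subst₂ E corner side (E-sym f₄))
              (subst₂ E refl side f₂) (E-sym e₁) g₀ gU gR
    step p Dn (_ , e₂ , _) (f₁ , f₂ , f₃ , _) (g₀ , gR , gU , g₁) =
      proj₁ new , agree-subst (sym side) (proj₂ new) , agree-subst (sym back) g₀ , agree-subst (sym corner) gR
      where
      q : Point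
      q = p ⊕ vec Dn
      back : q ⊕ vec Up ≡ p
      back = cancel p _ _ refl
      corner : q ⊕ one ≡ p ⊕ vec Rt
      corner = merge p _ _
      side : q ⊕ vec Rt ≡ (p ⊕ vec Rt) ⊕ vec Dn
      side = regroup p _ _ _ _ refl
      new : Agree (p ⊕ vec Dn) × Agree ((p ⊕ vec Rt) ⊕ vec Dn)
      new = across p Rt Up RU (subst₂ E back refl (E-sym f₂)) (subst₂ E corner side (E-sym f₃))
              (subst₂ E refl side f₁) (E-sym e₂) g₀ gR gU

    module _ (m : ℕ) (squares : ∀ p → Cell m p → Square E p) where
      propagate : ∀ {p q} → Chain m p q → AgreeCell p → AgreeCell q
      propagate here                        g = g
      propagate (next δ ch cell cell' refl) g = step _ δ (squares _ cell) (squares _ cell') (propagate ch g)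

      rigid : ∀ {p q} → Cell m p → Cell m q → AgreeCell p → AgreeCell q
      rigid {p} {q} cp cq = propagate (chain-trans (chain-sym (from-origin m p cp)) (from-origin m q cq))

-- § 9. Isomorphisms between the graphs Γ_w are injective unit-step maps.

adj-sym : ∀ w u q → Adj w u q → Adj w q u
adj-sym w u q (m , e) = m , edge-sym m _ _ e

adj-step : ∀ w u q → Adj w u q → Σ Dir λ δ → q ≡ u ⊕ vec δ
adj-step w u q (m , e) with edge-step m _ _ e
... | δ , h = δ , (begin
  q                     ≡⟨ sym (⊕-⊖ q R) ⟩
  (q ⊕ R) ⊖ R           ≡⟨ cong (_⊖ R) h ⟩
  ((u ⊕ R) ⊕ vec δ) ⊖ R ≡⟨ pointwise (eq (proj₁ u) (proj₁ R) (proj₁ (vec δ))) (eq (proj₂ u) (proj₂ R) (proj₂ (vec δ))) ⟩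
  u ⊕ vec δ             ∎)
  where open ≡-Reasoning
        R : Point
        R = root w m
        eq : ∀ (x r d : ℤ) → x + r + d - r ≡ x + d
        eq = solve-∀

module Isomorphism {w w' : W} (iso : Iso w w') where
  f : Point → Point
  f = proj₁ iso

  f-vertex : ∀ u → Vertex w u → Vertex w' (f u)
  f-vertex = proj₁ (proj₂ (proj₂ iso))

  f-inj : ∀ p q → Vertex w p → Vertex w q → f p ≡ f q → p ≡ q
  f-inj p q vp vq eq = trans (sym (g∘f p vp)) (trans (cong g eq) (g∘f q vq))
    where g : Point → Point
          g = proj₁ (proj₂ iso)
          g∘f : ∀ u → Vertex w u → g (f u) ≡ u
          g∘f = proj₁ (proj₂ (proj₂ (proj₂ (proj₂ iso))))

  f-step : ∀ u q → Adj w u q → Σ Dir λ δ → f q ≡ f u ⊕ vec δ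
  f-step u q adj = adj-step w' (f u) (f q) (Equivalence.to (preserves u q (q , adj) (u , adj-sym w u q adj)) adj)
    where preserves : ∀ u q → Vertex w u → Vertex w q → Adj w u q ⇔ Adj w' (f u) (f q)
          preserves = proj₂ (proj₂ (proj₂ (proj₂ (proj₂ (proj₂ iso)))))

root-cell : ∀ xs K → Cell K (root (a , xs) K)
root-cell xs zero    = refl
root-cell xs (suc K) = cell-lift K (xs K) _ (root-cell xs K)

-- § 10. An isomorphism out of Γ_{(a, x)} is a lattice isometry on every cell.

module Rigid {xs : ℕ → X} {w' : W} (iso : Iso (a , xs) w') where
  open Isomorphism iso

  private
    w : W
    w = (a , xs)

    unit-square : Square (Adj w) O
    unit-square = (0 , ab) , (0 , ad) , (0 , bc) , (0 , dc)

    module OnΓ = UnitStepMap (λ {u} {q} → adj-sym w u q) f (λ {u} {q} → f-step u q)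
                   (λ {p} {p'} {q} {q'} e e' → f-inj p q (p' , e) (q' , e'))

    base : OnΓ.ImageSquare O
    base = OnΓ.square-image O unit-square

  v : Point
  v = f O

  σ τ : Dir
  σ = proj₁ base
  τ = proj₁ (proj₂ base)

  π : Perp σ τ
  π = proj₁ (proj₂ (proj₂ base))

  -- At level K, measured from the root R of Γ^{K+1}_w, F = f (· − R) is an
  -- injective unit-step map on Γ_{K+1} and A = v + ⟦π⟧ (· − R) an isometry
  -- agreeing with it on the root cell.
  module _ (K : ℕ) where
    private
      R : Point
      R = root w K
      F : Point → Point
      F z = f (z ⊖ R)
      A : Point → Point
      A z = isometry v π (z ⊖ R)

      back : ∀ {p q} → Edge K p q → Adj w (p ⊖ R) (q ⊖ R)
      back {p} {q} e = K , edge-subst (sym (⊖-⊕ p R)) (sym (⊖-⊕ q R)) e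

      unshift : ∀ {p q} → p ⊖ R ≡ q ⊖ R → p ≡ q
      unshift {p} {q} h = trans (sym (⊖-⊕ p R)) (trans (cong (_⊕ R) h) (⊖-⊕ q R))

      module OnΓK = UnitStepMap (λ {p} {q} → edge-sym K p q) F (λ {p} {q} e → f-step (p ⊖ R) (q ⊖ R) (back e))
                      (λ {p} {p'} {q} {q'} e e' h → unshift (f-inj _ _ (p' ⊖ R , back e) (q' ⊖ R , back e') h))

      A-step : ∀ p δ → A (p ⊕ vec δ) ≡ A p ⊕ vec (turn σ τ δ)
      A-step p δ = trans (cong (isometry v π) (sym (commute p R (vec δ)))) (isometry-step v π (p ⊖ R) δ)

      open OnΓK.Agreement A π A-step

      at-root : ∀ u → f u ≡ isometry v π u → Agree (R ⊕ u)
      at-root u h = trans (cong f (shifted u)) (trans h (cong (isometry v π) (sym (shifted u))))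
        where shifted : ∀ u → (R ⊕ u) ⊖ R ≡ u
              shifted u = trans (cong (_⊖ R) (⊕-comm R u)) (⊕-⊖ u R)

      root-agrees : AgreeCell R
      root-agrees =
        agree-subst (⊕-identityʳ R) (at-root O (sym (trans (cong (v ⊕_) (⟦⟧-O π)) (⊕-identityʳ v)))) ,
        at-root (vec Rt) (trans f-Rt (sym (cong (v ⊕_) (⟦⟧-vec π Rt)))) ,
        at-root (vec Up) (trans f-Up (sym (cong (v ⊕_) (⟦⟧-vec π Up)))) ,
        at-root one (trans f-one (sym (begin
          v ⊕ ⟦ π ⟧ (vec Rt ⊕ vec Up)           ≡⟨ cong (v ⊕_) (⟦⟧-⊕ π (vec Rt) (vec Up)) ⟩
          v ⊕ (⟦ π ⟧ (vec Rt) ⊕ ⟦ π ⟧ (vec Up)) ≡⟨ cong₂ (λ p q → v ⊕ (p ⊕ q)) (⟦⟧-vec π Rt) (⟦⟧-vec π Up) ⟩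
          v ⊕ (vec σ ⊕ vec τ)                   ≡⟨ sym (⊕-assoc v _ _) ⟩
          (v ⊕ vec σ) ⊕ vec τ                   ∎)))
        where
        open ≡-Reasoning
        f-Rt : f (vec Rt) ≡ v ⊕ vec σ
        f-Rt = proj₁ (proj₂ (proj₂ (proj₂ base)))
        f-Up : f (vec Up) ≡ v ⊕ vec τ
        f-Up = proj₁ (proj₂ (proj₂ (proj₂ (proj₂ base))))
        f-one : f one ≡ (v ⊕ vec σ) ⊕ vec τ
        f-one = proj₂ (proj₂ (proj₂ (proj₂ (proj₂ base))))

    agrees : ∀ q → Cell K q → f (q ⊖ root w K) ≡ isometry v π (q ⊖ root w K)
    agrees q cq = proj₁ (rigid K (cell-square K) (root-cell xs K) cq root-agrees)

-- § 11. Steering a cell corner into a hole by the choice of one letter.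

OneMod3 : ℤ → Set
OneMod3 z = z ℤD.%ℕ 3 ≡ 1

oneMod3 : ∀ z → OneMod3 z → z ≡ + 1 + (z ℤD./ℕ 3) * + 3
oneMod3 z h = trans (ℤD.a≡a%ℕn+[a/ℕn]*n z 3) (cong (λ r → + r + (z ℤD./ℕ 3) * + 3) h)

residue : ℤ → Fin 3
residue z = F.fromℕ< (ℤD.n%ℕd<d z 3)

steer : ∀ (ρx ρy : Fin 3) → Σ X λ x → Σ X λ k →
        OneMod3 (+ F.toℕ ρx + (proj₁ (t k) - proj₁ (t x))) × OneMod3 (+ F.toℕ ρy + (proj₂ (t k) - proj₂ (t x)))
steer = from-yes (FP.all? λ (ρx : Fin 3) → FP.all? λ (ρy : Fin 3) → FP.any? λ (x : X) → FP.any? λ (k : X) →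
  ((+ F.toℕ ρx + (proj₁ (t k) - proj₁ (t x))) ℤD.%ℕ 3 ℕ.≟ 1) ×-dec
  ((+ F.toℕ ρy + (proj₂ (t k) - proj₂ (t x))) ℤD.%ℕ 3 ℕ.≟ 1))

two-if : Bool → ℤ
two-if true  = + 2
two-if false = + 0

corner : Bool → Bool → X
corner false false = F.# 0
corner true  false = F.# 2
corner false true  = F.# 6
corner true  true  = F.# 4

corner-t : ∀ bx by → t (corner bx by) ≡ (two-if bx , two-if by)
corner-t false false = refl
corner-t true  false = refl
corner-t false true  = refl
corner-t true  true  = refl

index : ℕ → ℤ → ℤ
index i z = (z ℤD./ℕ (3 ℕ.^ suc i)) {{ℕP.m^n≢0 3 (suc i)}}

remainder : ℕ → ℤ → ℕ
remainder i z = (z ℤD.%ℕ (3 ℕ.^ suc i)) {{ℕP.m^n≢0 3 (suc i)}}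

private
  block-decomposition : ∀ i z → z ≡ + remainder i z + index i z * pow3 (suc i)
  block-decomposition i z =
    trans (ℤD.a≡a%ℕn+[a/ℕn]*n z (3 ℕ.^ suc i) {{ℕP.m^n≢0 3 (suc i)}})
          (cong (λ P → + remainder i z + index i z * P) (sym (pow3≡ (suc i))))

  remainder-< : ∀ i z → remainder i z ℕ.< 3 ℕ.^ suc i
  remainder-< i z = ℤD.n%ℕd<d z (3 ℕ.^ suc i) {{ℕP.m^n≢0 3 (suc i)}}

  middle-index : ℕ → ℤ → ℤ → ℤ
  middle-index i γ u = γ ℤD./ℕ 3 + (+ (γ ℤD.%ℕ 3) + u) ℤD./ℕ 3

  recentre : ∀ i r γ u e → OneMod3 (+ F.toℕ (residue γ) + u) →
    (+ r + γ * pow3 (suc i)) + (pow3 (suc i) * u + pow3 i * e) ≡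
    pow3 (suc (suc i)) * middle-index i γ u + pow3 (suc i) + (+ r + pow3 i * e)
  recentre i r γ u e ≡1 = begin
    (+ r + γ * M) + (M * u + P * e)                  ≡⟨ cong (λ g → (+ r + g * M) + (M * u + P * e)) γ≡ ⟩
    (+ r + (+ ρ + q * + 3) * M) + (M * u + P * e)    ≡⟨ expand (+ r) (+ ρ) q u M (P * e) ⟩
    + r + M * (+ ρ + u) + + 3 * M * q + P * e        ≡⟨ cong (λ v → + r + M * v + + 3 * M * q + P * e) u≡ ⟩
    + r + M * (+ 1 + q' * + 3) + + 3 * M * q + P * e ≡⟨ collect (+ r) q q' M (P * e) ⟩
    + 3 * M * (q + q') + M + (+ r + P * e)           ∎
    where
    open ≡-Reasoning
    M P : ℤ
    M = pow3 (suc i)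
    P = pow3 i
    ρ : ℕ
    ρ = γ ℤD.%ℕ 3
    q q' : ℤ
    q = γ ℤD./ℕ 3
    q' = (+ ρ + u) ℤD./ℕ 3
    γ≡ : γ ≡ + ρ + q * + 3
    γ≡ = ℤD.a≡a%ℕn+[a/ℕn]*n γ 3
    u≡ : + ρ + u ≡ + 1 + q' * + 3
    u≡ = oneMod3 (+ ρ + u) (subst (λ n → OneMod3 (+ n + u)) (FP.toℕ-fromℕ< (ℤD.n%ℕd<d γ 3)) ≡1)
    expand : ∀ r ρ q u M x → (r + (ρ + q * + 3) * M) + (M * u + x) ≡ r + M * (ρ + u) + + 3 * M * q + x
    expand = solve-∀
    collect : ∀ r q q' M x → r + M * (+ 1 + q' * + 3) + + 3 * M * q + x ≡ + 3 * M * (q + q') + M + (r + x)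
    collect = solve-∀

  into-middle : ∀ i r γ u e → r ℕ.< 3 ℕ.^ suc i → e ≡ two-if (r ℕ.≡ᵇ 0) →
    OneMod3 (+ F.toℕ (residue γ) + u) →
    MiddleThird (suc i) ((+ r + γ * pow3 (suc i)) + (pow3 (suc i) * u + pow3 i * e))
  into-middle i zero γ u e _ refl ≡1 =
    middle-index i γ u , 3 ℕ.^ i ℕ.* 2 ,
    trans (recentre i 0 γ u e ≡1) (cong (λ x → pow3 (suc (suc i)) * middle-index i γ u + pow3 (suc i) + x)
      (trans (ℤP.+-identityˡ _) (trans (cong (_* + 2) (pow3≡ i)) (sym (ℤP.pos-* (3 ℕ.^ i) 2))))) ,
    ℕP.≤-trans (ℕP.m^n>0 3 i) (ℕP.m≤m*n (3 ℕ.^ i) 2) ,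
    subst (3 ℕ.^ i ℕ.* 2 ℕ.<_) (ℕP.*-comm (3 ℕ.^ i) 3) (ℕP.*-monoʳ-< (3 ℕ.^ i) {{ℕP.m^n≢0 3 i}} (s≤s (s≤s (s≤s z≤n))))
  into-middle i (suc r) γ u e r< refl ≡1 =
    middle-index i γ u , suc r ,
    trans (recentre i (suc r) γ u e ≡1) (cong (λ x → pow3 (suc (suc i)) * middle-index i γ u + pow3 (suc i) + x) (no-nudge (+ suc r) (pow3 i))) ,
    s≤s z≤n , r<
    where no-nudge : ∀ (x P : ℤ) → x + P * + 0 ≡ x
          no-nudge = solve-∀

  coordinate-hit : ∀ i z w u e → e ≡ two-if (remainder i z ℕ.≡ᵇ 0) → OneMod3 (+ F.toℕ (residue (index i z)) + (w - u)) →
                   MiddleThird (suc i) (z + ((pow3 (suc i) * w + pow3 i * e) - pow3 (suc i) * u))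
  coordinate-hit i z w u e e≡ ≡1 =
    subst (MiddleThird (suc i)) (sym eq)
          (into-middle i (remainder i z) (index i z) (w - u) e (remainder-< i z) e≡ ≡1)
    where
    eq : z + ((pow3 (suc i) * w + pow3 i * e) - pow3 (suc i) * u) ≡
         (+ remainder i z + index i z * pow3 (suc i)) + (pow3 (suc i) * (w - u) + pow3 i * e)
    eq = trans (reorder z (pow3 (suc i)) (pow3 i) w u e) (cong (_+ (pow3 (suc i) * (w - u) + pow3 i * e)) (block-decomposition i z))
      where reorder : ∀ z M P w u e → z + ((M * w + P * e) - M * u) ≡ z + (M * (w - u) + P * e)
            reorder = solve-∀

cell-corner : ℕ → X → X → Point
cell-corner i k k' = offset (suc i) k ⊕ offset i k'

hit : ∀ i C → Σ X λ x → Σ X λ k → Σ X λ k' → InHole (suc i) (C ⊕ (cell-corner i k k' ⊖ offset (suc i) x))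
hit i C with steer (residue (index i (proj₁ C))) (residue (index i (proj₂ C)))
... | x , k , steer-x , steer-y = x , k , corner bx by ,
  coordinate-hit i (proj₁ C) (proj₁ (t k)) (proj₁ (t x)) _ (cong proj₁ (corner-t bx by)) steer-x ,
  coordinate-hit i (proj₂ C) (proj₂ (t k)) (proj₂ (t x)) _ (cong proj₂ (corner-t bx by)) steer-y
  where
  -- the corner sub-copy sits in an outer column (row) iff the remainder is 0
  bx by : Bool
  bx = remainder i (proj₁ C) ℕ.≡ᵇ 0
  by = remainder i (proj₂ C) ℕ.≡ᵇ 0

-- The offset to be steered into a hole at step i+1, against the candidate
-- isometry p ↦ v + ⟦π⟧ p into Γ_{w'}, when the current root is ρ.
aim : W → Point → ∀ {σ τ} → Perp σ τ → ℕ → Point → Point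
aim w' v π i ρ = ⟦ π ⟧⁻¹ ((v ⊖ ⟦ π ⟧ ρ) ⊕ root w' (suc (suc i)))

aim-image : ∀ w' v {σ τ} (π : Perp σ τ) i ρ q s →
            ⟦ π ⟧ (aim w' v π i ρ ⊕ (q ⊖ s)) ≡ isometry v π (q ⊖ (ρ ⊕ s)) ⊕ root w' (suc (suc i))
aim-image w' v π i ρ q s = begin
  ⟦ π ⟧ (C ⊕ Z)                  ≡⟨ ⟦⟧-⊕ π C Z ⟩
  ⟦ π ⟧ C ⊕ ⟦ π ⟧ Z              ≡⟨ cong (_⊕ ⟦ π ⟧ Z) (⟦⟧-inverse π _) ⟩
  ((v ⊖ ⟦ π ⟧ ρ) ⊕ R') ⊕ ⟦ π ⟧ Z ≡⟨ pointwise (swap (proj₁ v) _ _ _) (swap (proj₂ v) _ _ _) ⟩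
  (v ⊕ (⟦ π ⟧ Z ⊖ ⟦ π ⟧ ρ)) ⊕ R' ≡⟨ cong (λ u → (v ⊕ u) ⊕ R') (sym (⟦⟧-⊖ π Z ρ)) ⟩
  (v ⊕ ⟦ π ⟧ (Z ⊖ ρ)) ⊕ R'       ≡⟨ cong (λ u → (v ⊕ ⟦ π ⟧ u) ⊕ R') subtract-both ⟩
  (v ⊕ ⟦ π ⟧ (q ⊖ (ρ ⊕ s))) ⊕ R' ∎
  where
  open ≡-Reasoning
  C Z R' : Point
  C = aim w' v π i ρ
  Z = q ⊖ s
  R' = root w' (suc (suc i))
  swap : ∀ (v ρ r z : ℤ) → v - ρ + r + z ≡ v + (z - ρ) + r
  swap = solve-∀
  subtract-both : (q ⊖ s) ⊖ ρ ≡ q ⊖ (ρ ⊕ s)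
  subtract-both = pointwise (eq (proj₁ q) (proj₁ ρ) (proj₁ s)) (eq (proj₂ q) (proj₂ ρ) (proj₂ s))
    where eq : ∀ (q ρ s : ℤ) → q - s - ρ ≡ q - (ρ + s)
          eq = solve-∀

corner-cell : ∀ i k k' → Cell (suc (suc i)) (cell-corner i k k')
corner-cell i k k' = k , subst (Cell (suc i)) eq (copy-origin i k')
  where eq : O ⊕ offset i k' ≡ cell-corner i k k' ⊖ offset (suc i) k
        eq = pointwise (solve (proj₁ (offset (suc i) k)) (proj₁ (offset i k')))
                       (solve (proj₂ (offset (suc i) k)) (proj₂ (offset i k')))
          where solve : ∀ (K L : ℤ) → + 0 + L ≡ K + L - K
                solve = solve-∀

refute : ∀ {xs w'} (iso : Iso (a , xs) w') i →
         xs (suc i) ≡ proj₁ (hit i (aim w' (Rigid.v iso) (Rigid.π iso) i (root (a , xs) (suc i)))) → ⊥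
refute {xs} {w'} iso i x≡ = hole-not-vertex w' (suc i) (f p) in-hole (f-vertex p p-vertex)
  where
  open Isomorphism iso
  open Rigid iso
  ρ C : Point
  ρ = root (a , xs) (suc i)
  C = aim w' v π i ρ
  x k k' : X
  x = proj₁ (hit i C)
  k = proj₁ (proj₂ (hit i C))
  k' = proj₁ (proj₂ (proj₂ (hit i C)))
  hole : InHole (suc i) (C ⊕ (cell-corner i k k' ⊖ offset (suc i) x))
  hole = proj₂ (proj₂ (proj₂ (hit i C)))
  q RK p : Point
  q = cell-corner i k k'
  RK = root (a , xs) (suc (suc i))
  p = q ⊖ RK
  p-vertex : Vertex (a , xs) p
  p-vertex = (q ⊕ vec Rt) ⊖ RK , suc (suc i) ,
             edge-subst (sym (⊖-⊕ q RK)) (sym (⊖-⊕ (q ⊕ vec Rt) RK)) (proj₁ (cell-square _ q (corner-cell i k k')))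
  RK≡ : RK ≡ ρ ⊕ offset (suc i) x
  RK≡ = cong (λ y → ρ ⊕ offset (suc i) y) x≡
  image : ⟦ π ⟧ (C ⊕ (q ⊖ offset (suc i) x)) ≡ f p ⊕ root w' (suc (suc i))
  image = begin
    ⟦ π ⟧ (C ⊕ (q ⊖ offset (suc i) x))                                ≡⟨ aim-image w' v π i ρ q (offset (suc i) x) ⟩
    isometry v π (q ⊖ (ρ ⊕ offset (suc i) x)) ⊕ root w' (suc (suc i)) ≡⟨ cong (λ r → isometry v π (q ⊖ r) ⊕ root w' (suc (suc i))) (sym RK≡) ⟩
    isometry v π p ⊕ root w' (suc (suc i))                            ≡⟨ cong (_⊕ root w' (suc (suc i))) (sym (agrees (suc (suc i)) q (corner-cell i k k'))) ⟩
    f p ⊕ root w' (suc (suc i))                                       ∎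
    where open ≡-Reasoning
  in-hole : InHole (suc i) (f p ⊕ root w' (suc (suc i)))
  in-hole = subst (InHole (suc i)) image (hole-⟦⟧ (suc i) π _ hole)

-- § 13. Countably many candidate isomorphisms.

Enumeration : Set → Set
Enumeration A = Σ (ℕ → A) λ e → ∀ x → Σ ℕ λ n → e n ≡ x

diagonal-step : ℕ × ℕ → ℕ × ℕ
diagonal-step (m , zero)  = (zero , suc m)
diagonal-step (m , suc n) = (suc m , n)

unpair : ℕ → ℕ × ℕ
unpair zero    = (0 , 0)
unpair (suc k) = diagonal-step (unpair k)

unpair-onto : ∀ s m n → m ℕ.+ n ≡ s → Σ ℕ λ k → unpair k ≡ (m , n)
unpair-onto s zero zero _ = 0 , refl
unpair-onto s (suc m) n eq with unpair-onto s m (suc n) (trans (ℕP.+-suc m n) eq)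
... | k , h = suc k , cong diagonal-step h
unpair-onto (suc s) zero (suc n) eq with unpair-onto s n zero (trans (ℕP.+-identityʳ n) (ℕP.suc-injective eq))
... | k , h = suc k , cong diagonal-step h

enum-× : ∀ {A B : Set} → Enumeration A → Enumeration B → Enumeration (A × B)
enum-× (eA , ontoA) (eB , ontoB) = (λ k → eA (proj₁ (unpair k)) , eB (proj₂ (unpair k))) , onto
  where
  onto : ∀ xy → Σ ℕ λ k → (eA (proj₁ (unpair k)) , eB (proj₂ (unpair k))) ≡ xy
  onto (x , y) with ontoA x | ontoB y
  ... | m , refl | n , refl with unpair-onto (m ℕ.+ n) m n refl
  ... | k , h = k , cong (λ mn → eA (proj₁ mn) , eB (proj₂ mn)) h

enum-ℕ : Enumeration ℕ
enum-ℕ = (λ n → n) , λ n → n , refl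

enum-ℤ : Enumeration ℤ
enum-ℤ = (λ k → signed (unpair k)) , onto
  where
  signed : ℕ × ℕ → ℤ
  signed (m , zero)  = + m
  signed (m , suc n) = -[1+ n ]
  onto : ∀ z → Σ ℕ λ k → signed (unpair k) ≡ z
  onto (+ m) with unpair-onto m m 0 (ℕP.+-identityʳ m)
  ... | k , h = k , cong signed h
  onto -[1+ n ] with unpair-onto (suc n) 0 (suc n) refl
  ... | k , h = k , cong signed h

Frame : Set
Frame = Σ Dir λ σ → Σ Dir λ τ → Perp σ τ

enum-Frame : Enumeration Frame
enum-Frame = frame , onto
  where
  frame : ℕ → Frame
  frame 0 = _ , _ , RU
  frame 1 = _ , _ , RD
  frame 2 = _ , _ , LU
  frame 3 = _ , _ , LD
  frame 4 = _ , _ , UR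
  frame 5 = _ , _ , UL
  frame 6 = _ , _ , DR
  frame _ = _ , _ , DL
  onto : ∀ φ → Σ ℕ λ n → frame n ≡ φ
  onto (_ , _ , RU) = 0 , refl
  onto (_ , _ , RD) = 1 , refl
  onto (_ , _ , LU) = 2 , refl
  onto (_ , _ , LD) = 3 , refl
  onto (_ , _ , UR) = 4 , refl
  onto (_ , _ , UL) = 5 , refl
  onto (_ , _ , DR) = 6 , refl
  onto (_ , _ , DL) = 7 , refl

-- A candidate isomorphism: a target graph Γ_{e n} and a lattice isometry.
Candidate : Set
Candidate = ℕ × Point × Frame

candidates : Enumeration Candidate
candidates = enum-× enum-ℕ (enum-× (enum-× enum-ℤ enum-ℤ) enum-Frame)

-- § 14. The diagonal word.

module Diagonal (e : ℕ → W) where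
  against : Candidate → ℕ → Point → X
  against (n , v , σ , τ , π) i ρ = proj₁ (hit i (aim (e n) v π i ρ))

  letter : ℕ → Point → X
  letter zero    ρ = F.zero
  letter (suc i) ρ = against (proj₁ candidates i) i ρ

  positions : ℕ → Point
  positions zero    = O
  positions (suc m) = positions m ⊕ offset m (letter m (positions m))

  word : ℕ → X
  word m = letter m (positions m)

  root-word : ∀ m → root (a , word) m ≡ positions m
  root-word zero    = refl
  root-word (suc m) = cong (_⊕ offset m (word m)) (root-word m)

mainTheorem3 : ¬ (Σ (ℕ → W) λ e → ∀ (w : W) → Σ ℕ λ n → Iso w (e n))
mainTheorem3 (e , covers) = refute iso i chosen
  where
  open Diagonal e
  n : ℕ
  n = proj₁ (covers (a , word))
  iso : Iso (a , word) (e n)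
  iso = proj₂ (covers (a , word))
  open Rigid iso using (v; σ; τ; π)
  -- the isometry of the isomorphism is the candidate examined at step i+1
  i : ℕ
  i = proj₁ (proj₂ candidates (n , v , σ , τ , π))
  examined : proj₁ candidates i ≡ (n , v , σ , τ , π)
  examined = proj₂ (proj₂ candidates (n , v , σ , τ , π))
  chosen : word (suc i) ≡ proj₁ (hit i (aim (e n) v π i (root (a , word) (suc i))))
  chosen = trans (cong (λ cand → against cand i (positions (suc i))) examined)
                 (cong (λ ρ → proj₁ (hit i (aim (e n) v π i ρ))) (sym (root-word (suc i))))
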